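{- For all $n\ge 2$, $\overline{q}_n(132,213,312)=2n$.
   Context: For a positive integer $n$, let $\mathcal{S}_{n,n}$ denote the set of all permutations (words) $\pi=\pi_1\cdots\pi_{2n}$ of the multiset $\{1,1,2,2,\ldots,n,n\}$. A word $\pi$ contains a pattern $\sigma=\sigma_1\cdots\sigma_k$ if there are indices $i_1<\cdots<i_k$ such that $\pi_{i_a}=\pi_{i_b}$ iff $\sigma_a=\sigma_b$ and $\pi_{i_a}<\pi_{i_b}$ iff $\sigma_a<\sigma_b$ for all $a,b$; otherwise $\pi$ avoids $\sigma$. The quasi-Stirling permutations $\overline{\mathcal{Q}}_n$ are the $\pi\in\mathcal{S}_{n,n}$ avoiding both $1212$ and $2121$. For a set $\Lambda$ of patterns, $\overline{\mathcal{Q}}_n(\Lambda)$ is the set of $\pi\in\overline{\mathcal{Q}}_n$ avoiding every pattern in $\Lambda$, and $\overline{q}_n(\Lambda)=|\overline{\mathcal{Q}}_n(\Lambda)|$. -}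

module Defs where

open import Data.Nat using (ℕ; suc; _<_)
open import Data.List using (List; []; _∷_; length; lookup; map; concatMap; upTo)
open import Data.List.Relation.Binary.Sublist.Propositional using (_⊆_)
open import Data.List.Relation.Binary.Permutation.Propositional using (_↭_)
open import Data.List.Relation.Unary.All using (All)
open import Data.List.Relation.Unary.Unique.Propositional using (Unique)
open import Data.List.Membership.Propositional using (_∈_)
open import Data.Fin using (Fin; cast)
open import Data.Product using (Σ; _×_; ∃)
open import Function.Bundles using (_⇔_)
open import Relation.Binary.PropositionalEquality using (_≡_)
open import Relation.Nullary using (¬_)

Word : Set
Word = List ℕ

doubled : ℕ → Word
doubled n = concatMap (λ i → suc i ∷ suc i ∷ []) (upTo n)

InS : ℕ → Word → Set
InS n π = π ↭ doubled n

OrderIso : Word → Word → Set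
OrderIso σ τ =
  Σ (length σ ≡ length τ) λ eq →
    ∀ (a b : Fin (length σ)) →
      ((lookup σ a ≡ lookup σ b) ⇔ (lookup τ (cast eq a) ≡ lookup τ (cast eq b)))
      × ((lookup σ a < lookup σ b) ⇔ (lookup τ (cast eq a) < lookup τ (cast eq b)))

Contains : Word → Word → Set
Contains π σ = ∃ λ τ → (τ ⊆ π) × OrderIso σ τ

Avoids : Word → Word → Set
Avoids π σ = ¬ Contains π σ

p1212 p2121 : Word
p1212 = 1 ∷ 2 ∷ 1 ∷ 2 ∷ []
p2121 = 2 ∷ 1 ∷ 2 ∷ 1 ∷ []

InQbar : ℕ → Word → Set
InQbar n π = InS n π × Avoids π p1212 × Avoids π p2121

InQbarΛ : ℕ → List Word → Word → Set
InQbarΛ n Λ π = InQbar n π × All (Avoids π) Λ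

HasCard : ℕ → List Word → ℕ → Set
HasCard n Λ k = ∃ λ (L : List Word) →
  Unique L × (∀ π → (π ∈ L) ⇔ InQbarΛ n Λ π) × (length L ≡ k)

-- Let n ≥ 3 and π ∈ Q̄ₙ(132, 213, 312). If letters x, y ≥ 2 surround a 1 (x before it, y after
-- it), then x = y, for otherwise x 1 y is an occurrence of 213 or 312. So a 1 with larger letters
-- on both sides would force all letters ≥ 2 to be equal, which fails since 2 and 3 both occur.
-- Hence the two 1s stand both at the start, at both ends, or both at the end of π. In the first
-- two cases the other letters increase weakly (a descent after a 1 would give 132), which leaves
-- the single words 11 22⋯nn and 1 22⋯nn 1; in the last case π = (π′ + 1) 11 with
-- π′ ∈ Q̄ₙ₋₁(132, 213, 312). All these words lie in the class, so q̄ₙ = q̄ₙ₋₁ + 2, and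
-- q̄₂ = 4 through 1122, 1221, 2112, 2211.

module Submission where

open import Defs
open import Data.Empty using (⊥; ⊥-elim)
open import Data.Fin as Fin using (cast; toℕ)
open import Data.Fin.Patterns using (0F; 1F; 2F; 3F)
open import Data.Fin.Properties using (toℕ-cast; cast-is-id)
open import Data.List using (List; []; _∷_; _++_; map; length; lookup; applyUpTo; concatMap; filter)
open import Data.List.Membership.Propositional using (_∈_; _∉_)
open import Data.List.Membership.Propositional.Properties using (∈-map⁻; ∈-map⁺; ∈-++⁻; ∈-++⁺ʳ; ∈-∃++)
open import Data.List.Properties
  using (length-map; ++-assoc; ++-identityʳ; ++-cancelʳ; map-∘; map-id; map-id-local; map-injective)
open import Data.List.Relation.Binary.Permutation.Propositional
  using (_↭_; ↭-sym; ↭-trans; ↭-refl; prep; swap; ↭⇒↭ₛ)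
import Data.List.Relation.Binary.Permutation.Propositional.Properties as ↭ₚ
open import Data.List.Relation.Binary.Pointwise using (Pointwise-≡⇒≡)
open import Data.List.Relation.Binary.Sublist.Propositional
  using (_⊆_; []; _∷_; _∷ʳ_; ⊆-refl; ⊆-trans; from∈; minimum)
import Data.List.Relation.Binary.Sublist.Propositional as Sublist
open import Data.List.Relation.Binary.Sublist.Propositional.Properties as Sublistₚ using (++⁺; ++⁺ʳ)
open import Data.List.Relation.Unary.All as All using (All; []; _∷_)
import Data.List.Relation.Unary.All.Properties as Allₚ
open import Data.List.Relation.Unary.AllPairs as AllPairs using (AllPairs; []; _∷_)
import Data.List.Relation.Unary.AllPairs.Properties as AllPairsₚ
open import Data.List.Relation.Unary.Any using (here; there)
open import Data.List.Relation.Unary.Sorted.TotalOrder using (Sorted)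
open import Data.List.Relation.Unary.Sorted.TotalOrder.Properties using (AllPairs⇒Sorted; ↗↭↗⇒≋)
open import Data.List.Relation.Unary.Unique.Propositional using (Unique)
import Data.List.Relation.Unary.Unique.Propositional.Properties as Uniqueₚ
open import Data.Nat using (ℕ; zero; suc; pred; _+_; _*_; _≤_; _<_; z≤n; s≤s; _≟_; _≤?_)
open import Data.Nat.Properties
open import Data.List.Relation.Binary.Sublist.DecPropositional _≟_ using (_⊆?_)
open import Data.Product using (_×_; ∃₂; _,_; proj₁; proj₂; ∃-syntax)
open import Data.Sum using (_⊎_; inj₁; inj₂)
open import Function using (_∘_; id)
open import Function.Bundles using (_⇔_; mk⇔; Equivalence)
open import Relation.Binary.Definitions using (tri<; tri≈; tri>)
open import Relation.Binary.PropositionalEquality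
  using (_≡_; _≢_; refl; sym; trans; cong; subst; subst₂; module ≡-Reasoning)
open import Relation.Nullary using (yes; no; contradiction)
open import Relation.Nullary.Decidable using (True; toWitness; from-no)

raise : Word → Word
raise = map suc

⊆-raise⁻ : ∀ {τ t : Word} → τ ⊆ raise t → ∃[ τ′ ] τ′ ⊆ t × τ ≡ raise τ′
⊆-raise⁻ {t = []} [] = [] , [] , refl
⊆-raise⁻ {t = x ∷ t} (_ ∷ʳ τ⊆) with ⊆-raise⁻ τ⊆
... | τ′ , τ′⊆ , refl = τ′ , x ∷ʳ τ′⊆ , refl
⊆-raise⁻ {t = x ∷ t} (refl ∷ τ⊆) with ⊆-raise⁻ τ⊆
... | τ′ , τ′⊆ , refl = x ∷ τ′ , refl ∷ τ′⊆ , refl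

⊆-++-∉ : ∀ t {s τ} {z : ℕ} → (τ ++ z ∷ []) ⊆ t ++ s → z ∉ s → (τ ++ z ∷ []) ⊆ t
⊆-++-∉ [] {τ = τ} τz⊆s z∉s = contradiction (Sublist.lookup τz⊆s (∈-++⁺ʳ τ (here refl))) z∉s
⊆-++-∉ (x ∷ t) {τ = []} (_ ∷ʳ z⊆) z∉s = x ∷ʳ ⊆-++-∉ t {τ = []} z⊆ z∉s
⊆-++-∉ (x ∷ t) {τ = []} (refl ∷ _) _ = refl ∷ minimum t
⊆-++-∉ (x ∷ t) {τ = _ ∷ τ} (_ ∷ʳ τz⊆) z∉s = x ∷ʳ ⊆-++-∉ t {τ = _ ∷ τ} τz⊆ z∉s
⊆-++-∉ (x ∷ t) {τ = _ ∷ τ} (refl ∷ τz⊆) z∉s = refl ∷ ⊆-++-∉ t {τ = τ} τz⊆ z∉s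

init-⊆ : ∀ t {τ} {z e : ℕ} → (τ ++ z ∷ []) ⊆ t ++ e ∷ [] → τ ⊆ t
init-⊆ [] {[]} _ = []
init-⊆ [] {_ ∷ []} (_ ∷ ())
init-⊆ [] {_ ∷ _ ∷ _} (_ ∷ ())
init-⊆ (x ∷ t) {[]} _ = minimum _
init-⊆ (x ∷ t) {τ} (_ ∷ʳ τz⊆) = x ∷ʳ init-⊆ t {τ} τz⊆
init-⊆ (x ∷ t) {_ ∷ τ} (refl ∷ τz⊆) = refl ∷ init-⊆ t {τ} τz⊆

straddle-⊆ : ∀ l r {a x y : ℕ} → x ∈ l → y ∈ r → (x ∷ a ∷ y ∷ []) ⊆ l ++ a ∷ r
straddle-⊆ l r x∈l y∈r = ++⁺ (from∈ x∈l) (refl ∷ from∈ y∈r)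

↭-split : ∀ {x : ℕ} {ρ π} → x ∷ ρ ↭ π → ∃₂ λ a b → π ≡ a ++ x ∷ b × a ++ b ↭ ρ
↭-split x∷ρ↭π with ∈-∃++ (↭ₚ.∈-resp-↭ x∷ρ↭π (here refl))
... | a , b , refl = a , b , refl , ↭ₚ.drop-mid a [] (↭-sym x∷ρ↭π)

↭-split₂ : ∀ {x : ℕ} {ρ π} → x ∷ x ∷ ρ ↭ π →
  ∃[ u ] ∃[ v ] ∃[ w ] π ≡ u ++ x ∷ v ++ x ∷ w × u ++ v ++ w ↭ ρ
↭-split₂ {x} {ρ} xxρ↭π with ↭-split xxρ↭π
... | a , b , refl , ab↭ with ∈-++⁻ a (↭ₚ.∈-resp-↭ (↭-sym ab↭) (here refl))
...   | inj₁ x∈a with u , v , refl ← ∈-∃++ x∈a =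
  u , v , b , ++-assoc u (x ∷ v) (x ∷ b) ,
  ↭ₚ.drop-mid u [] (subst (_↭ x ∷ ρ) (++-assoc u (x ∷ v) b) ab↭)
...   | inj₂ x∈b with v , w , refl ← ∈-∃++ x∈b =
  a , v , w , refl , subst (_↭ ρ) (++-assoc a v w) (↭ₚ.drop-mid (a ++ v) [] reassociated)
  where
  reassociated : (a ++ v) ++ x ∷ w ↭ x ∷ ρ
  reassociated = subst (_↭ x ∷ ρ) (sym (++-assoc a v (x ∷ w))) ab↭

Nondecreasing : Word → Set
Nondecreasing = AllPairs _≤_

raise-nondecreasing : ∀ {w} → Nondecreasing w → Nondecreasing (raise w)
raise-nondecreasing w↗ = AllPairsₚ.map⁺ (AllPairs.map s≤s w↗)

raise-positive : ∀ w → All (1 ≤_) (raise w)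
raise-positive w = Allₚ.map⁺ (All.universal (λ _ → s≤s z≤n) w)

module _ {A : Set} {R : A → A → Set} where

  AllPairs-⊆ : ∀ {xs y z} → AllPairs R xs → (y ∷ z ∷ []) ⊆ xs → R y z
  AllPairs-⊆ (_ ∷ pairs) (_ ∷ʳ yz⊆) = AllPairs-⊆ pairs yz⊆
  AllPairs-⊆ (rel ∷ _) (refl ∷ z⊆) = All.lookup rel (Sublist.to∈ z⊆)

  ⊆-pairs⇒AllPairs : ∀ {xs} → (∀ {y z} → (y ∷ z ∷ []) ⊆ xs → R y z) → AllPairs R xs
  ⊆-pairs⇒AllPairs {[]} _ = []
  ⊆-pairs⇒AllPairs {x ∷ xs} rel =
    All.tabulate (λ z∈ → rel (refl ∷ from∈ z∈)) ∷ ⊆-pairs⇒AllPairs (λ yz⊆ → rel (x ∷ʳ yz⊆))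

nondecreasing-↭⇒≡ : ∀ {xs ys} → Nondecreasing xs → Nondecreasing ys → xs ↭ ys → xs ≡ ys
nondecreasing-↭⇒≡ xs↗ ys↗ xs↭ys = Pointwise-≡⇒≡
  (↗↭↗⇒≋ ≤-totalOrder (sorted xs↗) (sorted ys↗) (↭⇒↭ₛ xs↭ys))
  where
  sorted : ∀ {ws} → Nondecreasing ws → Sorted ≤-totalOrder ws
  sorted = AllPairs⇒Sorted ≤-totalOrder

doubled-suc : ∀ n → doubled (suc n) ≡ 1 ∷ 1 ∷ raise (doubled n)
doubled-suc n = cong (λ t → 1 ∷ 1 ∷ t) (shift id n)
  where
  shift : ∀ (f : ℕ → ℕ) n →
    concatMap (λ i → suc i ∷ suc i ∷ []) (applyUpTo (suc ∘ f) n)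
      ≡ raise (concatMap (λ i → suc i ∷ suc i ∷ []) (applyUpTo f n))
  shift f zero = refl
  shift f (suc n) = cong (λ t → suc (suc (f 0)) ∷ suc (suc (f 0)) ∷ t) (shift (f ∘ suc) n)

∈-doubled⁻ : ∀ n {x} → x ∈ doubled n → 1 ≤ x × x ≤ n
∈-doubled⁻ (suc n) x∈ rewrite doubled-suc n with x∈
... | here refl = s≤s z≤n , s≤s z≤n
... | there (here refl) = s≤s z≤n , s≤s z≤n
... | there (there x∈raise) with ∈-map⁻ suc x∈raise
... | y , y∈ , refl = s≤s z≤n , s≤s (proj₂ (∈-doubled⁻ n y∈))

∈-doubled⁺ : ∀ n {x} → 1 ≤ x → x ≤ n → x ∈ doubled n
∈-doubled⁺ (suc n) {1} _ _ rewrite doubled-suc n = here refl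
∈-doubled⁺ (suc n) {suc (suc x)} _ (s≤s x<n) rewrite doubled-suc n =
  there (there (∈-map⁺ suc (∈-doubled⁺ n (s≤s z≤n) x<n)))

doubled-nondecreasing : ∀ n → Nondecreasing (doubled n)
doubled-nondecreasing zero = []
doubled-nondecreasing (suc n) rewrite doubled-suc n =
  (≤-refl ∷ raise-positive _) ∷ raise-positive _ ∷ raise-nondecreasing (doubled-nondecreasing n)

InS-positive : ∀ {n π} → InS n π → All (1 ≤_) π
InS-positive {n} π↭ = All.tabulate λ x∈ → proj₁ (∈-doubled⁻ n (↭ₚ.∈-resp-↭ π↭ x∈))

-- Order isomorphisms and containment

OrderPreserving : (σ τ : Word) → length σ ≡ length τ → Set
OrderPreserving σ τ eq = ∀ a b →
  (lookup σ a < lookup σ b → lookup τ (cast eq a) < lookup τ (cast eq b))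
  × (lookup σ a ≡ lookup σ b → lookup τ (cast eq a) ≡ lookup τ (cast eq b))

orderIso⇒preserves : ∀ {σ τ} (iso : OrderIso σ τ) → OrderPreserving σ τ (proj₁ iso)
orderIso⇒preserves (_ , iso) a b = Equivalence.to (proj₂ (iso a b)) , Equivalence.to (proj₁ (iso a b))

-- ℕ is totally ordered, so preserving < and = also reflects them.
preserves⇒orderIso : ∀ {σ τ} eq → OrderPreserving σ τ eq → OrderIso σ τ
preserves⇒orderIso {σ} {τ} eq pres =
  eq , λ a b → mk⇔ (proj₂ (pres a b)) (reflects-≡ a b) , mk⇔ (proj₁ (pres a b)) (reflects-< a b)
  where
  reflects-≡ : ∀ a b → lookup τ (cast eq a) ≡ lookup τ (cast eq b) → lookup σ a ≡ lookup σ b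
  reflects-≡ a b τa≡τb with <-cmp (lookup σ a) (lookup σ b)
  ... | tri< σa<σb _ _ = contradiction τa≡τb (<⇒≢ (proj₁ (pres a b) σa<σb))
  ... | tri≈ _ σa≡σb _ = σa≡σb
  ... | tri> _ _ σb<σa = contradiction (sym τa≡τb) (<⇒≢ (proj₁ (pres b a) σb<σa))
  reflects-< : ∀ a b → lookup τ (cast eq a) < lookup τ (cast eq b) → lookup σ a < lookup σ b
  reflects-< a b τa<τb with <-cmp (lookup σ a) (lookup σ b)
  ... | tri< σa<σb _ _ = σa<σb
  ... | tri≈ _ σa≡σb _ = contradiction (proj₂ (pres a b) σa≡σb) (<⇒≢ τa<τb)
  ... | tri> _ _ σb<σa = contradiction (proj₁ (pres b a) σb<σa) (<-asym τa<τb)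

orderIso-refl : ∀ σ → OrderIso σ σ
orderIso-refl σ = preserves⇒orderIso {σ} {σ} refl pres
  where
  pres : OrderPreserving σ σ refl
  pres a b rewrite cast-is-id refl a | cast-is-id refl b = id , id

lookup-raise : ∀ (xs : Word) i j → toℕ i ≡ toℕ j → lookup (raise xs) i ≡ suc (lookup xs j)
lookup-raise (x ∷ xs) 0F 0F _ = refl
lookup-raise (x ∷ xs) (Fin.suc i) (Fin.suc j) i≡j = lookup-raise xs i j (suc-injective i≡j)

module _ {σ τ : Word} where

  private
    raised-lookup : ∀ (eq : length σ ≡ length τ) (eq′ : length σ ≡ length (raise τ)) a →
      lookup (raise τ) (cast eq′ a) ≡ suc (lookup τ (cast eq a))
    raised-lookup eq eq′ a = lookup-raise τ _ _ (trans (toℕ-cast eq′ a) (sym (toℕ-cast eq a)))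

  orderIso-raise⁺ : OrderIso σ τ → OrderIso σ (raise τ)
  orderIso-raise⁺ iso@(eq , _) = preserves⇒orderIso {σ} {raise τ} eq′ pres
    where
    eq′ : length σ ≡ length (raise τ)
    eq′ = trans eq (sym (length-map suc τ))
    pres : OrderPreserving σ (raise τ) eq′
    pres a b with orderIso⇒preserves {σ} {τ} iso a b
    ... | pres-< , pres-≡ =
      (λ σa<σb → subst₂ _<_ (sym (raised a)) (sym (raised b)) (s≤s (pres-< σa<σb))) ,
      (λ σa≡σb → trans (raised a) (trans (cong suc (pres-≡ σa≡σb)) (sym (raised b))))
      where
      raised : ∀ a → lookup (raise τ) (cast eq′ a) ≡ suc (lookup τ (cast eq a))
      raised = raised-lookup eq eq′

  orderIso-raise⁻ : OrderIso σ (raise τ) → OrderIso σ τ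
  orderIso-raise⁻ iso@(eq′ , _) = preserves⇒orderIso {σ} {τ} eq pres
    where
    eq : length σ ≡ length τ
    eq = trans eq′ (length-map suc τ)
    pres : OrderPreserving σ τ eq
    pres a b with orderIso⇒preserves {σ} {raise τ} iso a b
    ... | pres-< , pres-≡ =
      (λ σa<σb → ≤-pred (subst₂ _<_ (raised a) (raised b) (pres-< σa<σb))) ,
      (λ σa≡σb → suc-injective (trans (sym (raised a)) (trans (pres-≡ σa≡σb) (raised b))))
      where
      raised : ∀ a → lookup (raise τ) (cast eq′ a) ≡ suc (lookup τ (cast eq a))
      raised = raised-lookup eq eq′

contains-self : ∀ σ → Contains σ σ
contains-self σ = σ , ⊆-refl , orderIso-refl σ

contains-⊆ : ∀ {π ρ σ} → π ⊆ ρ → Contains π σ → Contains ρ σ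
contains-⊆ π⊆ρ (τ , τ⊆π , iso) = τ , ⊆-trans τ⊆π π⊆ρ , iso

contains-raise : ∀ {π σ} → Contains π σ ⇔ Contains (raise π) σ
contains-raise {π} {σ} = mk⇔ raised lowered
  where
  raised : Contains π σ → Contains (raise π) σ
  raised (τ , τ⊆ , iso) = raise τ , Sublistₚ.map⁺ suc τ⊆ , orderIso-raise⁺ {σ} {τ} iso
  lowered : Contains (raise π) σ → Contains π σ
  lowered (τ , τ⊆ , iso) with ⊆-raise⁻ τ⊆
  ... | τ′ , τ′⊆ , refl = τ′ , τ′⊆ , orderIso-raise⁻ {σ} {τ′} iso

p132 p213 p312 : Word
p132 = 1 ∷ 3 ∷ 2 ∷ []
p213 = 2 ∷ 1 ∷ 3 ∷ []
p312 = 3 ∷ 1 ∷ 2 ∷ []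

Λ : List Word
Λ = p132 ∷ p213 ∷ p312 ∷ []

Λ₅ : List Word
Λ₅ = p1212 ∷ p2121 ∷ Λ

inQbarΛ-intro : ∀ {n π} → InS n π → All (Avoids π) Λ₅ → InQbarΛ n Λ π
inQbarΛ-intro π∈S (avoids-1212 ∷ avoids-2121 ∷ avoids-Λ) = (π∈S , avoids-1212 , avoids-2121) , avoids-Λ

avoids-Λ₅ : ∀ {n π} → InQbarΛ n Λ π → All (Avoids π) Λ₅
avoids-Λ₅ ((_ , avoids-1212 , avoids-2121) , avoids-Λ) = avoids-1212 ∷ avoids-2121 ∷ avoids-Λ

occurrence-132 : ∀ {τ} → OrderIso p132 τ → ∃[ x ] ∃[ y ] ∃[ z ] τ ≡ x ∷ y ∷ z ∷ [] × x < z × z < y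
occurrence-132 {x ∷ y ∷ z ∷ []} iso =
  x , y , z , refl , proj₁ (pres 0F 2F) (s≤s (s≤s z≤n)) , proj₁ (pres 2F 1F) (s≤s (s≤s (s≤s z≤n)))
  where
  pres : OrderPreserving p132 (x ∷ y ∷ z ∷ []) (proj₁ iso)
  pres = orderIso⇒preserves {p132} {x ∷ y ∷ z ∷ []} iso

occurrence-213 : ∀ {τ} → OrderIso p213 τ → ∃[ x ] ∃[ y ] ∃[ z ] τ ≡ x ∷ y ∷ z ∷ [] × y < x × x < z
occurrence-213 {x ∷ y ∷ z ∷ []} iso =
  x , y , z , refl , proj₁ (pres 1F 0F) (s≤s (s≤s z≤n)) , proj₁ (pres 0F 2F) (s≤s (s≤s (s≤s z≤n)))
  where
  pres : OrderPreserving p213 (x ∷ y ∷ z ∷ []) (proj₁ iso)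
  pres = orderIso⇒preserves {p213} {x ∷ y ∷ z ∷ []} iso

occurrence-312 : ∀ {τ} → OrderIso p312 τ → ∃[ x ] ∃[ y ] ∃[ z ] τ ≡ x ∷ y ∷ z ∷ [] × y < z × z < x
occurrence-312 {x ∷ y ∷ z ∷ []} iso =
  x , y , z , refl , proj₁ (pres 1F 2F) (s≤s (s≤s z≤n)) , proj₁ (pres 2F 0F) (s≤s (s≤s (s≤s z≤n)))
  where
  pres : OrderPreserving p312 (x ∷ y ∷ z ∷ []) (proj₁ iso)
  pres = orderIso⇒preserves {p312} {x ∷ y ∷ z ∷ []} iso

occurrence-1212 : ∀ {τ} → OrderIso p1212 τ → ∃[ x ] ∃[ y ] τ ≡ x ∷ y ∷ x ∷ y ∷ [] × x < y
occurrence-1212 {x ∷ y ∷ x′ ∷ y′ ∷ []} iso =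
  shape (proj₂ (pres 0F 2F) refl) (proj₂ (pres 1F 3F) refl) (proj₁ (pres 0F 1F) (s≤s (s≤s z≤n)))
  where
  pres : OrderPreserving p1212 (x ∷ y ∷ x′ ∷ y′ ∷ []) (proj₁ iso)
  pres = orderIso⇒preserves {p1212} {x ∷ y ∷ x′ ∷ y′ ∷ []} iso
  shape : x ≡ x′ → y ≡ y′ → x < y → ∃[ a ] ∃[ b ] x ∷ y ∷ x′ ∷ y′ ∷ [] ≡ a ∷ b ∷ a ∷ b ∷ [] × a < b
  shape refl refl x<y = x , y , refl , x<y

occurrence-2121 : ∀ {τ} → OrderIso p2121 τ → ∃[ x ] ∃[ y ] τ ≡ x ∷ y ∷ x ∷ y ∷ [] × y < x
occurrence-2121 {x ∷ y ∷ x′ ∷ y′ ∷ []} iso =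
  shape (proj₂ (pres 0F 2F) refl) (proj₂ (pres 1F 3F) refl) (proj₁ (pres 1F 0F) (s≤s (s≤s z≤n)))
  where
  pres : OrderPreserving p2121 (x ∷ y ∷ x′ ∷ y′ ∷ []) (proj₁ iso)
  pres = orderIso⇒preserves {p2121} {x ∷ y ∷ x′ ∷ y′ ∷ []} iso
  shape : x ≡ x′ → y ≡ y′ → y < x → ∃[ a ] ∃[ b ] x ∷ y ∷ x′ ∷ y′ ∷ [] ≡ a ∷ b ∷ a ∷ b ∷ [] × b < a
  shape refl refl y<x = x , y , refl , y<x

-- The implicit proof is found by evaluation, so this refutes closed hypotheses such as 3 < 2.
<-absurd : ∀ {A : Set} {m n} {n≤m : True (n ≤? m)} → m < n → A
<-absurd {n≤m = n≤m} m<n = contradiction (toWitness n≤m) (<⇒≱ m<n)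

contains-132 : ∀ {π x y z} → (x ∷ y ∷ z ∷ []) ⊆ π → x < z → z < y → Contains π p132
contains-132 {x = x} {y} {z} occ x<z z<y = _ , occ , preserves⇒orderIso {p132} {x ∷ y ∷ z ∷ []} refl pres
  where
  pres : OrderPreserving p132 (x ∷ y ∷ z ∷ []) refl
  pres 0F 0F = <-absurd , λ _ → refl
  pres 0F 1F = (λ _ → <-trans x<z z<y) , λ ()
  pres 0F 2F = (λ _ → x<z) , λ ()
  pres 1F 0F = <-absurd , λ ()
  pres 1F 1F = <-absurd , λ _ → refl
  pres 1F 2F = <-absurd , λ ()
  pres 2F 0F = <-absurd , λ ()
  pres 2F 1F = (λ _ → z<y) , λ ()
  pres 2F 2F = <-absurd , λ _ → refl

contains-213 : ∀ {π x y z} → (x ∷ y ∷ z ∷ []) ⊆ π → y < x → x < z → Contains π p213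
contains-213 {x = x} {y} {z} occ y<x x<z = _ , occ , preserves⇒orderIso {p213} {x ∷ y ∷ z ∷ []} refl pres
  where
  pres : OrderPreserving p213 (x ∷ y ∷ z ∷ []) refl
  pres 0F 0F = <-absurd , λ _ → refl
  pres 0F 1F = <-absurd , λ ()
  pres 0F 2F = (λ _ → x<z) , λ ()
  pres 1F 0F = (λ _ → y<x) , λ ()
  pres 1F 1F = <-absurd , λ _ → refl
  pres 1F 2F = (λ _ → <-trans y<x x<z) , λ ()
  pres 2F 0F = <-absurd , λ ()
  pres 2F 1F = <-absurd , λ ()
  pres 2F 2F = <-absurd , λ _ → refl

contains-312 : ∀ {π x y z} → (x ∷ y ∷ z ∷ []) ⊆ π → y < z → z < x → Contains π p312
contains-312 {x = x} {y} {z} occ y<z z<x = _ , occ , preserves⇒orderIso {p312} {x ∷ y ∷ z ∷ []} refl pres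
  where
  pres : OrderPreserving p312 (x ∷ y ∷ z ∷ []) refl
  pres 0F 0F = <-absurd , λ _ → refl
  pres 0F 1F = <-absurd , λ ()
  pres 0F 2F = <-absurd , λ ()
  pres 1F 0F = (λ _ → <-trans y<z z<x) , λ ()
  pres 1F 1F = <-absurd , λ _ → refl
  pres 1F 2F = (λ _ → y<z) , λ ()
  pres 2F 0F = (λ _ → z<x) , λ ()
  pres 2F 1F = <-absurd , λ ()
  pres 2F 2F = <-absurd , λ _ → refl

-- Words in Q̄ₙ(132, 213, 312)

HasDescent : Word → Set
HasDescent τ = ∃₂ λ y z → (y ∷ z ∷ []) ⊆ τ × z < y

occurrences-descend : All (λ σ → ∀ {τ} → OrderIso σ τ → HasDescent τ) Λ₅
occurrences-descend = d1212 ∷ d2121 ∷ d132 ∷ d213 ∷ d312 ∷ []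
  where
  d1212 : ∀ {τ} → OrderIso p1212 τ → HasDescent τ
  d1212 {τ} iso with occurrence-1212 {τ} iso
  ... | x , y , refl , x<y = y , x , x ∷ʳ refl ∷ refl ∷ y ∷ʳ [] , x<y
  d2121 : ∀ {τ} → OrderIso p2121 τ → HasDescent τ
  d2121 {τ} iso with occurrence-2121 {τ} iso
  ... | x , y , refl , y<x = x , y , refl ∷ refl ∷ x ∷ʳ y ∷ʳ [] , y<x
  d132 : ∀ {τ} → OrderIso p132 τ → HasDescent τ
  d132 {τ} iso with occurrence-132 {τ} iso
  ... | x , y , z , refl , _ , z<y = y , z , x ∷ʳ ⊆-refl , z<y
  d213 : ∀ {τ} → OrderIso p213 τ → HasDescent τ
  d213 {τ} iso with occurrence-213 {τ} iso
  ... | x , y , z , refl , y<x , _ = x , y , refl ∷ refl ∷ z ∷ʳ [] , y<x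
  d312 : ∀ {τ} → OrderIso p312 τ → HasDescent τ
  d312 {τ} iso with occurrence-312 {τ} iso
  ... | x , y , z , refl , y<z , z<x = x , y , refl ∷ refl ∷ z ∷ʳ [] , <-trans y<z z<x

nondecreasing-avoids : ∀ {π} → Nondecreasing π → All (Avoids π) Λ₅
nondecreasing-avoids {π} π↗ = All.map (λ {σ} → avoids {σ}) occurrences-descend
  where
  avoids : ∀ {σ} → (∀ {τ} → OrderIso σ τ → HasDescent τ) → Avoids π σ
  avoids descends (τ , τ⊆π , iso) with descends iso
  ... | y , z , yz⊆τ , z<y = <⇒≱ z<y (AllPairs-⊆ π↗ (⊆-trans yz⊆τ τ⊆π))

bracketed-avoids : ∀ {a M} → Nondecreasing M → All (a ≤_) M → All (Avoids (a ∷ M ++ a ∷ [])) Λ₅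
bracketed-avoids {a} {M} M↗ a≤M = a1212 ∷ a2121 ∷ a132 ∷ a213 ∷ a312 ∷ []
  where
  W : Word
  W = a ∷ M ++ a ∷ []
  a∷M↗ : Nondecreasing (a ∷ M)
  a∷M↗ = a≤M ∷ M↗
  bounded-below : ∀ {x} → x ∈ W → a ≤ x
  bounded-below (here refl) = ≤-refl
  bounded-below (there x∈) with ∈-++⁻ M x∈
  ... | inj₁ x∈M = All.lookup a≤M x∈M
  ... | inj₂ (here refl) = ≤-refl
  descent-ends-at-a : ∀ {y z} → (y ∷ z ∷ []) ⊆ W → z < y → z ≡ a
  descent-ends-at-a {y} {z} yz⊆ z<y with z ≟ a
  ... | yes z≡a = z≡a
  ... | no z≢a = contradiction (AllPairs-⊆ a∷M↗ yz⊆a∷M) (<⇒≱ z<y)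
    where
    yz⊆a∷M : (y ∷ z ∷ []) ⊆ a ∷ M
    yz⊆a∷M = ⊆-++-∉ (a ∷ M) {τ = y ∷ []} yz⊆ λ { (here z≡a) → z≢a z≡a }
  no-early-descent : ∀ {x y z} → (x ∷ y ∷ z ∷ []) ⊆ W → y < x → ⊥
  no-early-descent {x} {y} xyz⊆ y<x = <⇒≱ y<x (AllPairs-⊆ a∷M↗ (init-⊆ (a ∷ M) {x ∷ y ∷ []} xyz⊆))
  a1212 : Avoids W p1212
  a1212 (τ , τ⊆ , iso) with occurrence-1212 {τ} iso
  ... | x , y , refl , x<y = no-early-descent (⊆-trans (x ∷ʳ ⊆-refl) τ⊆) x<y
  a2121 : Avoids W p2121
  a2121 (τ , τ⊆ , iso) with occurrence-2121 {τ} iso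
  ... | x , y , refl , y<x = no-early-descent (⊆-trans (refl ∷ refl ∷ refl ∷ y ∷ʳ []) τ⊆) y<x
  a132 : Avoids W p132
  a132 (τ , τ⊆ , iso) with occurrence-132 {τ} iso
  ... | x , y , z , refl , x<z , z<y with descent-ends-at-a (⊆-trans (x ∷ʳ ⊆-refl) τ⊆) z<y
  ... | refl = <⇒≱ x<z (bounded-below (Sublist.lookup τ⊆ (here refl)))
  a213 : Avoids W p213
  a213 (τ , τ⊆ , iso) with occurrence-213 {τ} iso
  ... | x , y , z , refl , y<x , _ = no-early-descent τ⊆ y<x
  a312 : Avoids W p312
  a312 (τ , τ⊆ , iso) with occurrence-312 {τ} iso
  ... | x , y , z , refl , y<z , z<x = no-early-descent τ⊆ (<-trans y<z z<x)

ones-first : ℕ → Word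
ones-first m = 1 ∷ 1 ∷ raise (doubled m)

ones-outside : ℕ → Word
ones-outside m = 1 ∷ raise (doubled m) ++ 1 ∷ []

ones-last : Word → Word
ones-last π = raise π ++ 1 ∷ 1 ∷ []

ones-first∈Q̄ : ∀ m → InQbarΛ (suc m) Λ (ones-first m)
ones-first∈Q̄ m = subst (InQbarΛ (suc m) Λ) (doubled-suc m)
  (inQbarΛ-intro {suc m} ↭-refl (nondecreasing-avoids (doubled-nondecreasing (suc m))))

ones-outside∈Q̄ : ∀ m → InQbarΛ (suc m) Λ (ones-outside m)
ones-outside∈Q̄ m = inQbarΛ-intro {suc m} permutation
  (bracketed-avoids (raise-nondecreasing (doubled-nondecreasing m)) (raise-positive (doubled m)))
  where
  permutation : ones-outside m ↭ doubled (suc m)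
  permutation rewrite doubled-suc m = prep 1 (↭ₚ.++-comm (raise (doubled m)) (1 ∷ []))

ones-last-avoids : ∀ {π} → All (1 ≤_) π → All (Avoids π) Λ₅ → All (Avoids (ones-last π)) Λ₅
ones-last-avoids {π} π-positive (avoids-1212 ∷ avoids-2121 ∷ avoids-132 ∷ avoids-213 ∷ avoids-312 ∷ []) =
  transfer avoids-1212 c1212 ∷ transfer avoids-2121 c2121 ∷
  transfer avoids-132 c132 ∷ transfer avoids-213 c213 ∷ transfer avoids-312 c312 ∷ []
  where
  transfer : ∀ {σ} → Avoids π σ → (∀ {τ} → OrderIso σ τ → τ ⊆ ones-last π → τ ⊆ raise π) →
    Avoids (ones-last π) σ
  transfer {σ} avoids-σ confined (τ , τ⊆ , iso) =
    avoids-σ (Equivalence.from (contains-raise {π} {σ}) (τ , confined iso τ⊆ , iso))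
  positive : ∀ {τ x} → τ ⊆ ones-last π → x ∈ τ → 1 ≤ x
  positive τ⊆ x∈τ with ∈-++⁻ (raise π) (Sublist.lookup τ⊆ x∈τ)
  ... | inj₁ x∈raise with ∈-map⁻ suc x∈raise
  ...   | _ , _ , refl = s≤s z≤n
  positive τ⊆ x∈τ | inj₂ (here refl) = ≤-refl
  positive τ⊆ x∈τ | inj₂ (there (here refl)) = ≤-refl
  confine : ∀ τ {z} → (τ ++ z ∷ []) ⊆ ones-last π → 1 < z → (τ ++ z ∷ []) ⊆ raise π
  confine τ τz⊆ 1<z = ⊆-++-∉ (raise π) {τ = τ} τz⊆ λ
    { (here refl) → <-irrefl refl 1<z
    ; (there (here refl)) → <-irrefl refl 1<z }
  c1212 : ∀ {τ} → OrderIso p1212 τ → τ ⊆ ones-last π → τ ⊆ raise π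
  c1212 {τ} iso τ⊆ with occurrence-1212 {τ} iso
  ... | x , y , refl , x<y = confine (x ∷ y ∷ x ∷ []) τ⊆ (≤-<-trans (positive τ⊆ (here refl)) x<y)
  -- The last letter of a 2121 may be a trailing 1 a priori, but it repeats the second letter,
  -- which already lies in raise π.
  c2121 : ∀ {τ} → OrderIso p2121 τ → τ ⊆ ones-last π → τ ⊆ raise π
  c2121 {τ} iso τ⊆ with occurrence-2121 {τ} iso
  ... | x , y , refl , y<x with ∈-map⁻ suc (Sublist.lookup xyx⊆ (there (here refl)))
    where
    xyx⊆ : (x ∷ y ∷ x ∷ []) ⊆ raise π
    xyx⊆ = confine (x ∷ y ∷ []) (⊆-trans (refl ∷ refl ∷ refl ∷ y ∷ʳ []) τ⊆)
      (≤-<-trans (positive τ⊆ (there (here refl))) y<x)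
  ... | w , w∈π , refl = confine (x ∷ suc w ∷ x ∷ []) τ⊆ (s≤s (All.lookup π-positive w∈π))
  c132 : ∀ {τ} → OrderIso p132 τ → τ ⊆ ones-last π → τ ⊆ raise π
  c132 {τ} iso τ⊆ with occurrence-132 {τ} iso
  ... | x , y , z , refl , x<z , _ = confine (x ∷ y ∷ []) τ⊆ (≤-<-trans (positive τ⊆ (here refl)) x<z)
  c213 : ∀ {τ} → OrderIso p213 τ → τ ⊆ ones-last π → τ ⊆ raise π
  c213 {τ} iso τ⊆ with occurrence-213 {τ} iso
  ... | x , y , z , refl , _ , x<z = confine (x ∷ y ∷ []) τ⊆ (≤-<-trans (positive τ⊆ (here refl)) x<z)
  c312 : ∀ {τ} → OrderIso p312 τ → τ ⊆ ones-last π → τ ⊆ raise π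
  c312 {τ} iso τ⊆ with occurrence-312 {τ} iso
  ... | x , y , z , refl , y<z , _ = confine (x ∷ y ∷ []) τ⊆ (≤-<-trans (positive τ⊆ (there (here refl))) y<z)

ones-last∈Q̄ : ∀ {m π} → InQbarΛ m Λ π → InQbarΛ (suc m) Λ (ones-last π)
ones-last∈Q̄ {m} {π} π∈Q̄@((π↭ , _) , _) =
  inQbarΛ-intro {suc m} permutation (ones-last-avoids (InS-positive {m} π↭) (avoids-Λ₅ {m} π∈Q̄))
  where
  permutation : ones-last π ↭ doubled (suc m)
  permutation rewrite doubled-suc m =
    ↭-trans (↭ₚ.++-comm (raise π) (1 ∷ 1 ∷ [])) (prep 1 (prep 1 (↭ₚ.map⁺ suc π↭)))

two-valued-avoids-Λ : ∀ {π} → (∀ {x} → x ∈ π → 1 ≤ x × x ≤ 2) → All (Avoids π) Λ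
two-valued-avoids-Λ {π} two-valued = a132 ∷ a213 ∷ a312 ∷ []
  where
  no-chain : ∀ {a b c} → a ∈ π → c ∈ π → a < b → b < c → ⊥
  no-chain a∈ c∈ a<b b<c =
    ≤⇒≯ (proj₂ (two-valued c∈)) (≤-trans (s≤s (≤-trans (s≤s (proj₁ (two-valued a∈))) a<b)) b<c)
  a132 : Avoids π p132
  a132 (τ , τ⊆ , iso) with occurrence-132 {τ} iso
  ... | x , y , z , refl , x<z , z<y =
    no-chain (Sublist.lookup τ⊆ (here refl)) (Sublist.lookup τ⊆ (there (here refl))) x<z z<y
  a213 : Avoids π p213
  a213 (τ , τ⊆ , iso) with occurrence-213 {τ} iso
  ... | x , y , z , refl , y<x , x<z =
    no-chain (Sublist.lookup τ⊆ (there (here refl))) (Sublist.lookup τ⊆ (there (there (here refl)))) y<x x<z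
  a312 : Avoids π p312
  a312 (τ , τ⊆ , iso) with occurrence-312 {τ} iso
  ... | x , y , z , refl , y<z , z<x =
    no-chain (Sublist.lookup τ⊆ (there (here refl))) (Sublist.lookup τ⊆ (here refl)) y<z z<x

w2112 : Word
w2112 = 2 ∷ 1 ∷ 1 ∷ 2 ∷ []

w2112∈S : InS 2 w2112
w2112∈S = ↭-trans (swap 2 1 ↭-refl) (prep 1 (swap 2 1 ↭-refl))

w2112-avoids : All (Avoids w2112) Λ₅
w2112-avoids = a1212 ∷ a2121 ∷ two-valued-avoids-Λ in-range
  where
  in-range : ∀ {x} → x ∈ w2112 → 1 ≤ x × x ≤ 2
  in-range x∈ = ∈-doubled⁻ 2 (↭ₚ.∈-resp-↭ w2112∈S x∈)
  forced : ∀ {τ x y} → τ ⊆ w2112 → x ∈ τ → y ∈ τ → x < y → x ≡ 1 × y ≡ 2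
  forced τ⊆ x∈ y∈ x<y with in-range (Sublist.lookup τ⊆ x∈) | in-range (Sublist.lookup τ⊆ y∈)
  ... | 1≤x , _ | _ , y≤2 = ≤-antisym (≤-pred (≤-trans x<y y≤2)) 1≤x , ≤-antisym y≤2 (≤-trans (s≤s 1≤x) x<y)
  a1212 : Avoids w2112 p1212
  a1212 (τ , τ⊆ , iso) with occurrence-1212 {τ} iso
  ... | x , y , refl , x<y with forced τ⊆ (here refl) (there (here refl)) x<y
  ... | refl , refl = from-no (p1212 ⊆? w2112) τ⊆
  a2121 : Avoids w2112 p2121
  a2121 (τ , τ⊆ , iso) with occurrence-2121 {τ} iso
  ... | x , y , refl , y<x with forced τ⊆ (there (here refl)) (here refl) y<x
  ... | refl , refl = from-no (p2121 ⊆? w2112) τ⊆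

-- Classification

straddled-min⇒equal : ∀ {π x a y} → Avoids π p213 → Avoids π p312 →
  (x ∷ a ∷ y ∷ []) ⊆ π → a < x → a < y → x ≡ y
straddled-min⇒equal {x = x} {y = y} avoids-213 avoids-312 xay⊆π a<x a<y with <-cmp x y
... | tri< x<y _ _ = contradiction (contains-213 xay⊆π a<x x<y) avoids-213
... | tri≈ _ x≡y _ = x≡y
... | tri> _ _ y<x = contradiction (contains-312 xay⊆π a<y y<x) avoids-312

straddled-min⇒flat : ∀ l r {a x y p} → Avoids (l ++ a ∷ r) p213 → Avoids (l ++ a ∷ r) p312 →
  x ∈ l → y ∈ r → a < x → a < y → p ∈ l ++ a ∷ r → a < p → p ≡ y
straddled-min⇒flat l r avoids-213 avoids-312 x∈l y∈r a<x a<y p∈ a<p with ∈-++⁻ l p∈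
... | inj₁ p∈l = straddled-min⇒equal avoids-213 avoids-312 (straddle-⊆ l r p∈l y∈r) a<p a<y
... | inj₂ (here refl) = contradiction a<p (<-irrefl refl)
... | inj₂ (there p∈r) = trans
  (sym (straddled-min⇒equal avoids-213 avoids-312 (straddle-⊆ l r x∈l p∈r) a<x a<p))
  (straddled-min⇒equal avoids-213 avoids-312 (straddle-⊆ l r x∈l y∈r) a<x a<y)

nondecreasing-after-min : ∀ {π a w} → Avoids π p132 → (a ∷ w) ⊆ π → All (a <_) w → Nondecreasing w
nondecreasing-after-min {a = a} {w} avoids-132 aw⊆π a<w = ⊆-pairs⇒AllPairs ordered
  where
  ordered : ∀ {y z} → (y ∷ z ∷ []) ⊆ w → y ≤ z
  ordered {y} {z} yz⊆w = ≮⇒≥ λ z<y → avoids-132 (contains-132 (⊆-trans (refl ∷ yz⊆w) aw⊆π) a<z z<y)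
    where
    a<z : a < z
    a<z = All.lookup a<w (Sublist.lookup yz⊆w (there (here refl)))

ones-last⁻¹ : ∀ {m U} → U ↭ raise (doubled m) → All (Avoids (U ++ 1 ∷ 1 ∷ [])) Λ₅ →
  ∃[ π′ ] U ++ 1 ∷ 1 ∷ [] ≡ ones-last π′ × InQbarΛ m Λ π′
ones-last⁻¹ {m} {U} U↭ avoids =
  map pred U , cong (_++ 1 ∷ 1 ∷ []) (sym raise-pred) ,
  inQbarΛ-intro {m} pred-↭ (All.map (λ {σ} → lower {σ}) avoids)
  where
  raise-pred : raise (map pred U) ≡ U
  raise-pred = trans (sym (map-∘ U)) (map-id-local (All.tabulate suc-pred-U))
    where
    suc-pred-U : ∀ {x} → x ∈ U → suc (pred x) ≡ x
    suc-pred-U x∈ with ∈-map⁻ suc (↭ₚ.∈-resp-↭ U↭ x∈)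
    ... | _ , _ , refl = refl
  pred-↭ : map pred U ↭ doubled m
  pred-↭ = subst (map pred U ↭_) (trans (sym (map-∘ (doubled m))) (map-id (doubled m))) (↭ₚ.map⁺ pred U↭)
  lower : ∀ {σ} → Avoids (U ++ 1 ∷ 1 ∷ []) σ → Avoids (map pred U) σ
  lower {σ} avoids-σ contains-σ = avoids-σ (contains-⊆ {σ = σ} (++⁺ʳ _ ⊆-refl)
    (subst (λ t → Contains t σ) raise-pred (Equivalence.to (contains-raise {map pred U} {σ}) contains-σ)))

Classified : ℕ → Word → Set
Classified m π = π ≡ ones-first m ⊎ π ≡ ones-outside m ⊎ ∃[ π′ ] π ≡ ones-last π′ × InQbarΛ m Λ π′

module Classification {m : ℕ} (2≤m : 2 ≤ m) where

  above-one : ∀ {ρ x} → ρ ↭ raise (doubled m) → x ∈ ρ → 1 < x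
  above-one ρ↭ x∈ρ with ∈-map⁻ suc (↭ₚ.∈-resp-↭ ρ↭ x∈ρ)
  ... | y , y∈ , refl = s≤s (proj₁ (∈-doubled⁻ m y∈))

  raise-doubled↗ : Nondecreasing (raise (doubled m))
  raise-doubled↗ = raise-nondecreasing (doubled-nondecreasing m)

  no-straddled-one : ∀ l r {x y} → l ++ 1 ∷ r ↭ doubled (suc m) → All (Avoids (l ++ 1 ∷ r)) Λ₅ →
    x ∈ l → y ∈ r → 1 < x → 1 < y → ⊥
  no-straddled-one l r π↭ (_ ∷ _ ∷ _ ∷ avoids-213 ∷ avoids-312 ∷ []) x∈l y∈r 1<x 1<y =
    contradiction (trans (flat 2∈π (s≤s (s≤s z≤n))) (sym (flat 3∈π (s≤s (s≤s z≤n))))) λ ()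
    where
    flat : ∀ {p} → p ∈ l ++ 1 ∷ r → 1 < p → p ≡ _
    flat = straddled-min⇒flat l r avoids-213 avoids-312 x∈l y∈r 1<x 1<y
    2∈π : 2 ∈ l ++ 1 ∷ r
    2∈π = ↭ₚ.∈-resp-↭ (↭-sym π↭) (∈-doubled⁺ (suc m) (s≤s z≤n) (m≤n⇒m≤1+n 2≤m))
    3∈π : 3 ∈ l ++ 1 ∷ r
    3∈π = ↭ₚ.∈-resp-↭ (↭-sym π↭) (∈-doubled⁺ (suc m) (s≤s z≤n) (s≤s 2≤m))

  classify-split : ∀ u v w → u ++ 1 ∷ v ++ 1 ∷ w ↭ doubled (suc m) → All (Avoids (u ++ 1 ∷ v ++ 1 ∷ w)) Λ₅ →
    u ++ v ++ w ↭ raise (doubled m) → Classified m (u ++ 1 ∷ v ++ 1 ∷ w)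
  classify-split (x ∷ u) (y ∷ v) w π↭ avoids ρ↭ = ⊥-elim
    (no-straddled-one (x ∷ u) (y ∷ v ++ 1 ∷ w) π↭ avoids (here refl) (here refl)
      (above-one ρ↭ (here refl)) (above-one ρ↭ (∈-++⁺ʳ (x ∷ u) (here refl))))
  classify-split (x ∷ u) [] (y ∷ w) π↭ avoids ρ↭ = ⊥-elim
    (no-straddled-one (x ∷ u) (1 ∷ y ∷ w) π↭ avoids (here refl) (there (here refl))
      (above-one ρ↭ (here refl)) (above-one ρ↭ (∈-++⁺ʳ (x ∷ u) (here refl))))
  classify-split [] (x ∷ v) (y ∷ w) π↭ avoids ρ↭ = ⊥-elim
    (no-straddled-one (1 ∷ x ∷ v) (y ∷ w) π↭ avoids (there (here refl)) (here refl)
      (above-one ρ↭ (here refl)) (above-one ρ↭ (there (∈-++⁺ʳ v (here refl)))))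
  classify-split [] [] w π↭ (_ ∷ _ ∷ avoids-132 ∷ _) w↭ =
    inj₁ (cong (λ t → 1 ∷ 1 ∷ t) (nondecreasing-↭⇒≡ w↗ raise-doubled↗ w↭))
    where
    w↗ : Nondecreasing w
    w↗ = nondecreasing-after-min avoids-132 (1 ∷ʳ ⊆-refl) (All.tabulate (above-one w↭))
  classify-split [] v [] π↭ (_ ∷ _ ∷ avoids-132 ∷ _) ρ↭ =
    inj₂ (inj₁ (cong (λ t → 1 ∷ t ++ 1 ∷ []) (nondecreasing-↭⇒≡ v↗ raise-doubled↗ v↭)))
    where
    v↭ : v ↭ raise (doubled m)
    v↭ = subst (_↭ raise (doubled m)) (++-identityʳ v) ρ↭
    v↗ : Nondecreasing v
    v↗ = nondecreasing-after-min avoids-132 (refl ∷ ++⁺ʳ _ ⊆-refl) (All.tabulate (above-one v↭))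
  classify-split u [] [] π↭ avoids ρ↭ =
    inj₂ (inj₂ (ones-last⁻¹ {m} (subst (_↭ raise (doubled m)) (++-identityʳ u) ρ↭) avoids))

  classify : ∀ {π} → InQbarΛ (suc m) Λ π → Classified m π
  classify {π} π∈Q̄@((π↭ , _) , _) with ↭-split₂ (↭-sym (subst (π ↭_) (doubled-suc m) π↭))
  ... | u , v , w , refl , ρ↭ = classify-split u v w π↭ (avoids-Λ₅ {suc m} π∈Q̄) ρ↭

S₂₂ : List Word
S₂₂ = (1 ∷ 1 ∷ 2 ∷ 2 ∷ []) ∷ (1 ∷ 2 ∷ 1 ∷ 2 ∷ []) ∷ (1 ∷ 2 ∷ 2 ∷ 1 ∷ [])
    ∷ (2 ∷ 1 ∷ 1 ∷ 2 ∷ []) ∷ (2 ∷ 1 ∷ 2 ∷ 1 ∷ []) ∷ (2 ∷ 2 ∷ 1 ∷ 1 ∷ []) ∷ []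

InS-2-ones : ∀ {π} → InS 2 π → length (filter (_≟ 1) π) ≡ 2
InS-2-ones π↭ = ↭ₚ.↭-length (↭ₚ.filter-↭ (_≟ 1) π↭)

InS-2⇒∈S₂₂ : ∀ {π} → InS 2 π → π ∈ S₂₂
InS-2⇒∈S₂₂ {a ∷ b ∷ c ∷ d ∷ []} π↭ with one-or-two (here refl) | one-or-two (there (here refl))
  | one-or-two (there (there (here refl))) | one-or-two (there (there (there (here refl))))
  where
  one-or-two : ∀ {x} → x ∈ a ∷ b ∷ c ∷ d ∷ [] → x ≡ 1 ⊎ x ≡ 2
  one-or-two x∈ with ∈-doubled⁻ 2 (↭ₚ.∈-resp-↭ π↭ x∈)
  ... | s≤s z≤n , s≤s z≤n = inj₁ refl
  ... | s≤s z≤n , s≤s (s≤s z≤n) = inj₂ refl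
... | inj₁ refl | inj₁ refl | inj₂ refl | inj₂ refl = here refl
... | inj₁ refl | inj₂ refl | inj₁ refl | inj₂ refl = there (here refl)
... | inj₁ refl | inj₂ refl | inj₂ refl | inj₁ refl = there (there (here refl))
... | inj₂ refl | inj₁ refl | inj₁ refl | inj₂ refl = there (there (there (here refl)))
... | inj₂ refl | inj₁ refl | inj₂ refl | inj₁ refl = there (there (there (there (here refl))))
... | inj₂ refl | inj₂ refl | inj₁ refl | inj₁ refl = there (there (there (there (there (here refl)))))
... | inj₁ refl | inj₁ refl | inj₁ refl | inj₁ refl = contradiction (InS-2-ones π↭) λ ()
... | inj₁ refl | inj₁ refl | inj₁ refl | inj₂ refl = contradiction (InS-2-ones π↭) λ ()
... | inj₁ refl | inj₁ refl | inj₂ refl | inj₁ refl = contradiction (InS-2-ones π↭) λ ()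
... | inj₁ refl | inj₂ refl | inj₁ refl | inj₁ refl = contradiction (InS-2-ones π↭) λ ()
... | inj₂ refl | inj₁ refl | inj₁ refl | inj₁ refl = contradiction (InS-2-ones π↭) λ ()
... | inj₁ refl | inj₂ refl | inj₂ refl | inj₂ refl = contradiction (InS-2-ones π↭) λ ()
... | inj₂ refl | inj₁ refl | inj₂ refl | inj₂ refl = contradiction (InS-2-ones π↭) λ ()
... | inj₂ refl | inj₂ refl | inj₁ refl | inj₂ refl = contradiction (InS-2-ones π↭) λ ()
... | inj₂ refl | inj₂ refl | inj₂ refl | inj₁ refl = contradiction (InS-2-ones π↭) λ ()
... | inj₂ refl | inj₂ refl | inj₂ refl | inj₂ refl = contradiction (InS-2-ones π↭) λ ()
InS-2⇒∈S₂₂ {[]} π↭ with () ← ↭ₚ.↭-length π↭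
InS-2⇒∈S₂₂ {_ ∷ []} π↭ with () ← ↭ₚ.↭-length π↭
InS-2⇒∈S₂₂ {_ ∷ _ ∷ []} π↭ with () ← ↭ₚ.↭-length π↭
InS-2⇒∈S₂₂ {_ ∷ _ ∷ _ ∷ []} π↭ with () ← ↭ₚ.↭-length π↭
InS-2⇒∈S₂₂ {_ ∷ _ ∷ _ ∷ _ ∷ _ ∷ _} π↭ with () ← ↭ₚ.↭-length π↭

-- Counting

ones-last-injective : ∀ {π ρ} → ones-last π ≡ ones-last ρ → π ≡ ρ
ones-last-injective {π} {ρ} eq = map-injective suc-injective (++-cancelʳ (1 ∷ 1 ∷ []) (raise π) (raise ρ) eq)

ones-last-head : ∀ {n π t} → InS (suc n) π → 1 ∷ t ≢ ones-last π
ones-last-head {n} {[]} π↭ _ with () ← ↭ₚ.∈-resp-↭ (↭-sym π↭) (∈-doubled⁺ (suc n) ≤-refl (s≤s z≤n))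
ones-last-head {n} {x ∷ π} π↭ refl with () ← All.head (InS-positive {suc n} π↭)

enumeration : ℕ → List Word
enumeration zero = ones-first 1 ∷ ones-outside 1 ∷ w2112 ∷ ones-last (ones-first 0) ∷ []
enumeration (suc k) = ones-first (2 + k) ∷ ones-outside (2 + k) ∷ map ones-last (enumeration k)

enumeration-sound : ∀ k {π} → π ∈ enumeration k → InQbarΛ (2 + k) Λ π
enumeration-sound zero (here refl) = ones-first∈Q̄ 1
enumeration-sound zero (there (here refl)) = ones-outside∈Q̄ 1
enumeration-sound zero (there (there (here refl))) = inQbarΛ-intro {2} w2112∈S w2112-avoids
enumeration-sound zero (there (there (there (here refl)))) = ones-last∈Q̄ {1} (ones-first∈Q̄ 0)
enumeration-sound (suc k) (here refl) = ones-first∈Q̄ (2 + k)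
enumeration-sound (suc k) (there (here refl)) = ones-outside∈Q̄ (2 + k)
enumeration-sound (suc k) (there (there π∈)) with ∈-map⁻ ones-last π∈
... | π′ , π′∈ , refl = ones-last∈Q̄ {2 + k} (enumeration-sound k π′∈)

enumeration-complete : ∀ k {π} → InQbarΛ (2 + k) Λ π → π ∈ enumeration k
enumeration-complete zero ((π↭ , avoids-1212 , avoids-2121) , _) with InS-2⇒∈S₂₂ π↭
... | here refl = here refl
... | there (here refl) = ⊥-elim (avoids-1212 (contains-self p1212))
... | there (there (here refl)) = there (here refl)
... | there (there (there (here refl))) = there (there (here refl))
... | there (there (there (there (here refl)))) = ⊥-elim (avoids-2121 (contains-self p2121))
... | there (there (there (there (there (here refl))))) = there (there (there (here refl)))
enumeration-complete (suc k) π∈Q̄ with Classification.classify {2 + k} (s≤s (s≤s z≤n)) π∈Q̄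
... | inj₁ refl = here refl
... | inj₂ (inj₁ refl) = there (here refl)
... | inj₂ (inj₂ (π′ , refl , π′∈Q̄)) = there (there (∈-map⁺ ones-last (enumeration-complete k π′∈Q̄)))

enumeration-unique : ∀ k → Unique (enumeration k)
enumeration-unique zero = ((λ ()) ∷ (λ ()) ∷ (λ ()) ∷ []) ∷ ((λ ()) ∷ (λ ()) ∷ []) ∷ ((λ ()) ∷ []) ∷ [] ∷ []
enumeration-unique (suc k) =
  ((λ ()) ∷ not-ones-last) ∷ not-ones-last ∷ Uniqueₚ.map⁺ ones-last-injective (enumeration-unique k)
  where
  not-ones-last : ∀ {t} → All (1 ∷ t ≢_) (map ones-last (enumeration k))
  not-ones-last = Allₚ.map⁺ (All.tabulate λ π∈ →
    ones-last-head {1 + k} (proj₁ (proj₁ (enumeration-sound k π∈))))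

length-enumeration : ∀ k → length (enumeration k) ≡ 2 * (2 + k)
length-enumeration zero = refl
length-enumeration (suc k) = begin
  2 + length (map ones-last (enumeration k)) ≡⟨ cong (2 +_) (length-map ones-last (enumeration k)) ⟩
  2 + length (enumeration k)                 ≡⟨ cong (2 +_) (length-enumeration k) ⟩
  2 + 2 * (2 + k)                            ≡⟨ *-suc 2 (2 + k) ⟨
  2 * (3 + k)                                ∎
  where open ≡-Reasoning

theorem4p11 : ∀ (n : ℕ) → 2 ≤ n →
    HasCard n ((1 ∷ 3 ∷ 2 ∷ []) ∷ (2 ∷ 1 ∷ 3 ∷ []) ∷ (3 ∷ 1 ∷ 2 ∷ []) ∷ []) (2 * n)
theorem4p11 (suc (suc k)) _ =
  enumeration k , enumeration-unique k ,
  (λ π → mk⇔ (enumeration-sound k) (enumeration-complete k)) , length-enumeration k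
theorem4p11 (suc zero) (s≤s ())
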